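{- Let $(X_i)_{i\in\mathbb{N}}$ be non-commuting indeterminates over a field $\mathbb{K}$ of characteristic $0$, let $\mathbf{NMI}(n)$ ($n\geq1$) be the vector space with basis the words $X_{i_1}\cdots X_{i_n}$ of length $n$, and let $D$ be the derivation of $\mathbb{K}\langle X_i\mid i\in\mathbb{N}\rangle_+$ with $D(X_i)=X_{i+1}$ for all $i\in\mathbb{N}$. Define, for a word $X_{i_1}\cdots X_{i_n}$ of length $n$ and words $P_1,\dots,P_n$, $$X_{i_1}\cdots X_{i_n}\circ(P_1,\dots,P_n)=D^{i_1}(P_1)\cdots D^{i_n}(P_n),$$ extended multilinearly, and let $\mathfrak{S}_n$ act on the right on $\mathbf{NMI}(n)$ by $(X_{i_1}\cdots X_{i_n})^\sigma=X_{i_{\sigma(1)}}\cdots X_{i_{\sigma(n)}}$. Then $(\mathbf{NMI}(n))_{n\geq1}$ with this composition and this action is an operad, with unit $X_0\in\mathbf{NMI}(1)$. -}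

module Defs where

open import Level using (_⊔_)
open import Algebra.Bundles using (CommutativeRing)
open import Data.Nat as ℕ using (ℕ; zero; suc; _≤_)
open import Data.Fin using (Fin; zero; suc; _↑ˡ_; _↑ʳ_; splitAt)
open import Data.Fin.Permutation using (Permutation′; _⟨$⟩ʳ_; _∘ₚ_) renaming (id to idₚ)
open import Data.Vec as Vec using (Vec; []; _∷_; toList; lookup; tabulate)
open import Data.List using (List; []; _∷_; map; concatMap)
open import Data.List.Properties using (≡-dec)
open import Data.Product using (Σ; ∃; _×_; _,_; proj₁; proj₂)
open import Data.Sum using (inj₁; inj₂)
open import Relation.Nullary using (¬_; yes; no)
open import Relation.Binary.PropositionalEquality using (_≡_)

sumF : ∀ {n} → (Fin n → ℕ) → ℕ
sumF {zero}  m = 0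
sumF {suc n} m = m zero ℕ.+ sumF (λ j → m (suc j))

-- position r of block j  ↦  global position in the concatenation of blocks
flatten : ∀ {n} (m : Fin n → ℕ) (j : Fin n) → Fin (m j) → Fin (sumF m)
flatten {suc n} m zero    r = r ↑ˡ sumF (λ j → m (suc j))
flatten {suc n} m (suc j) r = m zero ↑ʳ flatten (λ j → m (suc j)) j r

unflatten : ∀ {n} (m : Fin n → ℕ) → Fin (sumF m) → Σ (Fin n) (λ j → Fin (m j))
unflatten {suc n} m i with splitAt (m zero) i
... | inj₁ r  = zero , r
... | inj₂ i′ = suc (proj₁ (unflatten (λ j → m (suc j)) i′)) , proj₂ (unflatten (λ j → m (suc j)) i′)

module _ {c ℓ} (R : CommutativeRing c ℓ) where
  open CommutativeRing R using (Carrier; _≈_; _+_; _*_; 0#; 1#)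

  fromℕ : ℕ → Carrier
  fromℕ zero    = 0#
  fromℕ (suc n) = 1# + fromℕ n

  record IsFieldChar0 : Set (c ⊔ ℓ) where
    field
      1≉0     : ¬ (1# ≈ 0#)
      inverse : ∀ x → ¬ (x ≈ 0#) → ∃ λ y → x * y ≈ 1#
      char0   : ∀ n → fromℕ n ≈ 0# → n ≡ 0

  -- A word X_{i1}...X_{ik} of the free algebra K<X_i | i ∈ ℕ> is the list [i1,...,ik];
  -- an element of the free algebra is a formal linear combination of words,
  -- two representatives being equal iff all their coefficients agree.
  Word : Set
  Word = List ℕ

  Poly : Set c
  Poly = List (Carrier × Word)

  coeff : Word → Poly → Carrier
  coeff w [] = 0#
  coeff w ((a , u) ∷ p) with ≡-dec ℕ._≟_ u w
  ... | yes _ = a + coeff w p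
  ... | no  _ = coeff w p

  _≈P_ : Poly → Poly → Set ℓ
  p ≈P q = ∀ w → coeff w p ≈ coeff w q

  NMI : ℕ → Set c
  NMI n = List (Carrier × Vec ℕ n)

  ι : ∀ {n} → NMI n → Poly
  ι = map (λ t → proj₁ t , toList (proj₂ t))

  _≈N_ : ∀ {n k} → NMI n → NMI k → Set ℓ
  p ≈N q = ι p ≈P ι q

  -- the derivation D with D(X_i) = X_{i+1}, on a word (Leibniz rule) and linearly
  Dword : ∀ {n} → Vec ℕ n → List (Vec ℕ n)
  Dword []      = []
  Dword (i ∷ x) = (suc i ∷ x) ∷ map (i ∷_) (Dword x)

  D : ∀ {n} → NMI n → NMI n
  D = concatMap (λ t → map (proj₁ t ,_) (Dword (proj₂ t)))

  D^ : ∀ {n} → ℕ → NMI n → NMI n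
  D^ zero    p = p
  D^ (suc i) p = D (D^ i p)

  _·_ : ∀ {n} → Carrier → NMI n → NMI n
  a · p = map (λ t → a * proj₁ t , proj₂ t) p

  mul : ∀ {a b} → NMI a → NMI b → NMI (a ℕ.+ b)
  mul p q = concatMap (λ s → map (λ t → proj₁ s * proj₁ t , proj₂ s Vec.++ proj₂ t) q) p

  prodF : ∀ {n} {m : Fin n → ℕ} → ((j : Fin n) → NMI (m j)) → NMI (sumF m)
  prodF {zero}  P = (1# , []) ∷ []
  prodF {suc n} P = mul (P zero) (prodF (λ j → P (suc j)))

  compWord : ∀ {n} {m : Fin n → ℕ} → Vec ℕ n → ((j : Fin n) → NMI (m j)) → NMI (sumF m)
  compWord x P = prodF (λ j → D^ (lookup x j) (P j))

  γ : ∀ {n} {m : Fin n → ℕ} → NMI n → ((j : Fin n) → NMI (m j)) → NMI (sumF m)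
  γ p P = concatMap (λ t → proj₁ t · compWord (proj₂ t) P) p

  act : ∀ {N N′} → (Fin N′ → Fin N) → NMI N → NMI N′
  act f = map (λ t → proj₁ t , tabulate (λ k → lookup (proj₂ t) (f k)))

  _^_ : ∀ {n} → NMI n → Permutation′ n → NMI n
  p ^ σ = act (σ ⟨$⟩ʳ_) p

  unit : NMI 1
  unit = (1# , 0 ∷ []) ∷ []

  -- block permutation σ(m_1,...,m_n): block k (size m_{σ(k)}) ↦ block σ(k)
  blockPerm : ∀ {n} (σ : Permutation′ n) (m : Fin n → ℕ) → Fin (sumF (λ k → m (σ ⟨$⟩ʳ k))) → Fin (sumF m)
  blockPerm σ m i = flatten m (σ ⟨$⟩ʳ proj₁ u) (proj₂ u)
    where u = unflatten (λ k → m (σ ⟨$⟩ʳ k)) i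

  blockSum : ∀ {n} (m : Fin n → ℕ) (τ : (j : Fin n) → Permutation′ (m j)) → Fin (sumF m) → Fin (sumF m)
  blockSum m τ i = flatten m (proj₁ u) (τ (proj₁ u) ⟨$⟩ʳ proj₂ u)
    where u = unflatten m i

  record IsNMIOperad : Set (c ⊔ ℓ) where
    field
      -- γ is well defined on the vector spaces (independent of representatives)
      γ-cong : ∀ {n} {m : Fin n → ℕ} (p p′ : NMI n) (q q′ : (j : Fin n) → NMI (m j)) →
               1 ≤ n → (∀ j → 1 ≤ m j) →
               p ≈N p′ → (∀ j → q j ≈N q′ j) → γ p q ≈N γ p′ q′
      act-cong : ∀ {n} (p p′ : NMI n) (σ : Permutation′ n) → 1 ≤ n →
                 p ≈N p′ → (p ^ σ) ≈N (p′ ^ σ)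
      act-id   : ∀ {n} (p : NMI n) → 1 ≤ n → (p ^ idₚ) ≈N p
      act-comp : ∀ {n} (p : NMI n) (σ τ : Permutation′ n) → 1 ≤ n →
                 ((p ^ σ) ^ τ) ≈N (p ^ (τ ∘ₚ σ))
      -- (τ ∘ₚ σ) is the permutation k ↦ σ (τ k)
      -- unit
      unit-left  : ∀ (m : Fin 1 → ℕ) (q : (j : Fin 1) → NMI (m j)) → 1 ≤ m zero →
                   γ unit q ≈N q zero
      unit-right : ∀ {n} (p : NMI n) → 1 ≤ n →
                   γ {m = λ _ → 1} p (λ _ → unit) ≈N p
      assoc : ∀ {n} {m : Fin n → ℕ} {l : (j : Fin n) → Fin (m j) → ℕ}
              (p : NMI n) (q : (j : Fin n) → NMI (m j))
              (r : (j : Fin n) (k : Fin (m j)) → NMI (l j k)) →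
              1 ≤ n → (∀ j → 1 ≤ m j) → (∀ j k → 1 ≤ l j k) →
              γ {m = λ i → l (proj₁ (unflatten m i)) (proj₂ (unflatten m i))}
                (γ p q) (λ i → r (proj₁ (unflatten m i)) (proj₂ (unflatten m i)))
              ≈N γ {m = λ j → sumF (l j)} p (λ j → γ (q j) (r j))
      equiv-σ : ∀ {n} {m : Fin n → ℕ} (p : NMI n) (q : (j : Fin n) → NMI (m j))
                (σ : Permutation′ n) → 1 ≤ n → (∀ j → 1 ≤ m j) →
                γ {m = λ k → m (σ ⟨$⟩ʳ k)} (p ^ σ) (λ k → q (σ ⟨$⟩ʳ k))
                ≈N act (blockPerm σ m) (γ p q)
      equiv-τ : ∀ {n} {m : Fin n → ℕ} (p : NMI n) (q : (j : Fin n) → NMI (m j))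
                (τ : (j : Fin n) → Permutation′ (m j)) → 1 ≤ n → (∀ j → 1 ≤ m j) →
                γ p (λ j → q j ^ τ j) ≈N act (blockSum m τ) (γ p q)

-- A formal combination p = Σ aₜ wₜ of words is determined by the functional
-- G ↦ ⟦ p ⟧ G = Σ aₜ G(wₜ) on test functions G from words to K: pairing with the
-- indicator of a word returns its coefficient.  The operations transpose to test
-- functions: D becomes ∂G(u) = Σ G(u′) over the words u′ obtained from u by
-- raising one letter, and a product P₁ ⋯ Pₙ becomes the iterated pairing of
-- P₁, …, Pₙ with G applied to concatenations.  Each operad axiom thereby becomes an
-- identity of iterated finite sums, which follows from multilinearity and
-- interchange of sums together with two facts about ∂: it satisfies the Leibniz
-- rule on concatenations, so D^e(q ∘ r) = (D^e q) ∘ r (associativity), and it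
-- commutes with permuting letters (equivariance).

module Submission where

open import Defs
open import Algebra.Bundles using (CommutativeRing)
import Algebra.Properties.CommutativeMonoid.Sum as MonoidSum
import Algebra.Properties.CommutativeSemigroup as CommutativeSemigroup
open import Data.Nat as ℕ using (ℕ; zero; suc; _<_)
import Data.Nat.Properties as ℕ
open import Data.Fin as Fin using (Fin; zero; suc; toℕ; _↑ˡ_; _↑ʳ_; punchIn)
import Data.Fin.Properties as Fin
open import Data.Fin.Permutation as Perm
  using (Permutation′; _⟨$⟩ʳ_; _⟨$⟩ˡ_; _∘ₚ_; remove; punchIn-permute) renaming (id to idₚ)
open import Data.List as List using (List; []; _∷_; _++_; map; concatMap; length; concat; deduplicate)
import Data.List.Properties as List
open import Data.List.Properties using (≡-dec)
open import Data.List.Membership.Propositional using (_∈_)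
open import Data.List.Membership.Propositional.Properties using (∈-map⁺; ∈-++⁺ˡ; ∈-++⁺ʳ; ∈-deduplicate⁺)
open import Data.List.Relation.Unary.Any using (here; there)
open import Data.List.Relation.Unary.All as All using (All; []; _∷_)
open import Data.List.Relation.Unary.AllPairs using (_∷_)
open import Data.List.Relation.Unary.Unique.Propositional using (Unique)
open import Data.List.Relation.Unary.Unique.DecPropositional.Properties using (deduplicate-!)
open import Data.Vec as Vec using (Vec; []; _∷_; toList; lookup; tabulate; insertAt; _⊛_)
import Data.Vec.Properties as Vec
open import Data.Product using (Σ; _×_; _,_; proj₁; proj₂; uncurry)
open import Data.Empty using (⊥-elim)
open import Function using (_∘_)
open import Relation.Nullary using (yes; no)
open import Relation.Binary.PropositionalEquality as ≡ using (_≡_; _≢_; _≗_)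

-- Out-of-range positions read as 0.
_!_ : List ℕ → ℕ → ℕ
[]       ! _     = 0
(x ∷ xs) ! zero  = x
(x ∷ xs) ! suc i = xs ! i

toList-! : ∀ {n} (x : Vec ℕ n) (k : Fin n) → toList x ! toℕ k ≡ lookup x k
toList-! (a ∷ x) zero    = ≡.refl
toList-! (a ∷ x) (suc k) = toList-! x k

++-!ˡ : ∀ (u v : List ℕ) {i} → i < length u → (u ++ v) ! i ≡ u ! i
++-!ˡ (a ∷ u) v {zero}  _            = ≡.refl
++-!ˡ (a ∷ u) v {suc i} (ℕ.s≤s i<u) = ++-!ˡ u v i<u

++-!ʳ : ∀ (u v : List ℕ) i → (u ++ v) ! (length u ℕ.+ i) ≡ v ! i
++-!ʳ []      v i = ≡.refl
++-!ʳ (a ∷ u) v i = ++-!ʳ u v i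

letter : ∀ {n} → List ℕ → Fin n → ℕ
letter w k = w ! toℕ k

toVec : ∀ {n} → List ℕ → Vec ℕ n
toVec w = tabulate (letter w)

toVec-toList : ∀ {n} (x : Vec ℕ n) → toVec (toList x) ≡ x
toVec-toList x = ≡.trans (Vec.tabulate-cong (toList-! x)) (Vec.tabulate∘lookup x)

toList-toVec : ∀ (u : List ℕ) {k} → length u ≡ k → toList (toVec {k} u) ≡ u
toList-toVec []      {zero}  _   = ≡.refl
toList-toVec (a ∷ u) {suc k} len = ≡.cong (a ∷_) (toList-toVec u (ℕ.suc-injective len))

concatWords : ∀ {n} → Vec (List ℕ) n → List ℕ
concatWords us = concat (toList us)

concatWords-++ : ∀ {a b} (us : Vec (List ℕ) a) (vs : Vec (List ℕ) b) →
                 concatWords (us Vec.++ vs) ≡ concatWords us ++ concatWords vs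
concatWords-++ us vs =
  ≡.trans (≡.cong concat (Vec.toList-++ us vs)) (≡.sym (List.concat-++ (toList us) (toList vs)))

lookup-ext : ∀ {a} {A : Set a} {n} (us vs : Vec A n) → lookup us ≗ lookup vs → us ≡ vs
lookup-ext us vs eq = ≡.trans (≡.sym (Vec.tabulate∘lookup us)) (≡.trans (Vec.tabulate-cong eq) (Vec.tabulate∘lookup vs))

tabulate-++ : ∀ {a} {A : Set a} m {n} (g : Fin (m ℕ.+ n) → A) →
              tabulate g ≡ tabulate (λ i → g (i ↑ˡ n)) Vec.++ tabulate (λ i → g (m ↑ʳ i))
tabulate-++ zero    g = ≡.refl
tabulate-++ (suc m) g = ≡.cong (g zero ∷_) (tabulate-++ m (g ∘ suc))

permute : ∀ {a} {A : Set a} {n} → Permutation′ n → Vec A n → Vec A n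
permute σ x = tabulate (λ k → lookup x (σ ⟨$⟩ʳ k))

permuteWord : ∀ {k} → Permutation′ k → List ℕ → List ℕ
permuteWord τ u = toList (tabulate (letter u ∘ (τ ⟨$⟩ʳ_)))

unflatten-↑ˡ : ∀ {n} (m : Fin (suc n) → ℕ) (i : Fin (m zero)) →
               unflatten m (i ↑ˡ sumF (m ∘ suc)) ≡ (zero , i)
unflatten-↑ˡ m i rewrite Fin.splitAt-↑ˡ (m zero) i (sumF (m ∘ suc)) = ≡.refl

unflatten-↑ʳ : ∀ {n} (m : Fin (suc n) → ℕ) (i : Fin (sumF (m ∘ suc))) →
               unflatten m (m zero ↑ʳ i) ≡ (suc (proj₁ (unflatten (m ∘ suc) i)) , proj₂ (unflatten (m ∘ suc) i))
unflatten-↑ʳ m i rewrite Fin.splitAt-↑ʳ (m zero) (sumF (m ∘ suc)) i = ≡.refl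

letter-++-↑ˡ : ∀ (u v : List ℕ) {a} b → length u ≡ a → (i : Fin a) → letter (u ++ v) (i ↑ˡ b) ≡ letter u i
letter-++-↑ˡ u v b len i = ≡.trans (≡.cong ((u ++ v) !_) (Fin.toℕ-↑ˡ i b))
  (++-!ˡ u v (≡.subst (toℕ i <_) (≡.sym len) (Fin.toℕ<n i)))

letter-++-↑ʳ : ∀ (u v : List ℕ) {a b} → length u ≡ a → (i : Fin b) → letter (u ++ v) (a ↑ʳ i) ≡ letter v i
letter-++-↑ʳ u v ≡.refl i = ≡.trans (≡.cong ((u ++ v) !_) (Fin.toℕ-↑ʳ (length u) i)) (++-!ʳ u v (toℕ i))

letter-flatten : ∀ {n} (m : Fin n → ℕ) (us : Vec (List ℕ) n) → (∀ j → length (lookup us j) ≡ m j) →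
                 ∀ j r → letter (concatWords us) (flatten m j r) ≡ letter (lookup us j) r
letter-flatten m (u ∷ us) len zero    r = letter-++-↑ˡ u (concatWords us) _ (len zero) r
letter-flatten m (u ∷ us) len (suc j) r =
  ≡.trans (letter-++-↑ʳ u (concatWords us) (len zero) _) (letter-flatten (m ∘ suc) us (len ∘ suc) j r)

toList-tabulate-unflatten : ∀ {n} (m : Fin n → ℕ) (vs : Vec (List ℕ) n) → (∀ j → length (lookup vs j) ≡ m j) →
  (f : Σ (Fin n) (λ j → Fin (m j)) → ℕ) → (∀ j r → f (j , r) ≡ letter (lookup vs j) r) →
  toList (tabulate {n = sumF m} (f ∘ unflatten m)) ≡ concatWords vs
toList-tabulate-unflatten m []       len f hf = ≡.refl
toList-tabulate-unflatten m (v ∷ vs) len f hf = begin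
  toList (tabulate (f ∘ unflatten m))
    ≡⟨ ≡.cong toList (tabulate-++ (m zero) (f ∘ unflatten m)) ⟩
  toList (tabulate (λ i → f (unflatten m (i ↑ˡ _))) Vec.++ tabulate (λ i → f (unflatten m (m zero ↑ʳ i))))
    ≡⟨ Vec.toList-++ (tabulate (λ i → f (unflatten m (i ↑ˡ sumF (m ∘ suc))))) (tabulate (λ i → f (unflatten m (m zero ↑ʳ i)))) ⟩
  toList (tabulate (λ i → f (unflatten m (i ↑ˡ _)))) ++ toList (tabulate (λ i → f (unflatten m (m zero ↑ʳ i))))
    ≡⟨ ≡.cong₂ _++_ first-block other-blocks ⟩
  v ++ concatWords vs ∎
  where
  open ≡.≡-Reasoning
  first-block  = ≡.trans (≡.cong toList (Vec.tabulate-cong (λ i → ≡.trans (≡.cong f (unflatten-↑ˡ m i)) (hf zero i))))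
                         (toList-toVec v (len zero))
  other-blocks = ≡.trans (≡.cong toList (Vec.tabulate-cong (λ i → ≡.cong f (unflatten-↑ʳ m i))))
                         (toList-tabulate-unflatten (m ∘ suc) vs (len ∘ suc) (λ (j , r) → f (suc j , r)) (hf ∘ suc))

bump : ∀ {n} → Vec ℕ n → Fin n → Vec ℕ n
bump (i ∷ x) zero    = suc i ∷ x
bump (i ∷ x) (suc k) = i ∷ bump x k

lookup-bump-≡ : ∀ {n} (y : Vec ℕ n) k → lookup (bump y k) k ≡ suc (lookup y k)
lookup-bump-≡ (i ∷ y) zero    = ≡.refl
lookup-bump-≡ (i ∷ y) (suc k) = lookup-bump-≡ y k

lookup-bump-≢ : ∀ {n} (y : Vec ℕ n) {k p} → k ≢ p → lookup (bump y k) p ≡ lookup y p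
lookup-bump-≢ (i ∷ y) {zero}  {zero}  k≢p = ⊥-elim (k≢p ≡.refl)
lookup-bump-≢ (i ∷ y) {zero}  {suc p} _   = ≡.refl
lookup-bump-≢ (i ∷ y) {suc k} {zero}  _   = ≡.refl
lookup-bump-≢ (i ∷ y) {suc k} {suc p} k≢p = lookup-bump-≢ y (k≢p ∘ ≡.cong suc)

permute-bump : ∀ {n} (τ : Permutation′ n) (y : Vec ℕ n) k → permute τ (bump y k) ≡ bump (permute τ y) (τ ⟨$⟩ˡ k)
permute-bump τ y k = lookup-ext _ _ (λ p → ≡.trans (Vec.lookup∘tabulate _ p) (at p))
  where
  at : ∀ p → lookup (bump y k) (τ ⟨$⟩ʳ p) ≡ lookup (bump (permute τ y) (τ ⟨$⟩ˡ k)) p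
  at p with τ ⟨$⟩ˡ k Fin.≟ p
  ... | yes ≡.refl rewrite Perm.inverseʳ τ {k} =
    ≡.trans (lookup-bump-≡ y k)
      (≡.sym (≡.trans (lookup-bump-≡ (permute τ y) (τ ⟨$⟩ˡ k))
        (≡.cong suc (≡.trans (Vec.lookup∘tabulate _ (τ ⟨$⟩ˡ k)) (≡.cong (lookup y) (Perm.inverseʳ τ))))))
  ... | no ne =
    ≡.trans (lookup-bump-≢ y (λ e → ne (≡.trans (≡.cong (τ ⟨$⟩ˡ_) e) (Perm.inverseˡ τ))))
      (≡.sym (≡.trans (lookup-bump-≢ (permute τ y) ne) (Vec.lookup∘tabulate _ p)))

module _ {c ℓ} (R : CommutativeRing c ℓ) where
  open CommutativeRing R hiding (zero)
  open import Relation.Binary.Reasoning.Setoid setoid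
  open CommutativeSemigroup +-commutativeSemigroup using () renaming (interchange to +-interchange)
  open CommutativeSemigroup *-commutativeSemigroup using () renaming (x∙yz≈y∙xz to x*yz≈y*xz)

  ∑ : ∀ {a} {A : Set a} → List A → (A → Carrier) → Carrier
  ∑ []       f = 0#
  ∑ (x ∷ xs) f = f x + ∑ xs f

  module _ {a} {A : Set a} where

    ∑-cong : ∀ (xs : List A) {f g : A → Carrier} → (∀ x → f x ≈ g x) → ∑ xs f ≈ ∑ xs g
    ∑-cong []       eq = refl
    ∑-cong (x ∷ xs) eq = +-cong (eq x) (∑-cong xs eq)

    ∑-++ : ∀ (xs ys : List A) f → ∑ (xs ++ ys) f ≈ ∑ xs f + ∑ ys f
    ∑-++ []       ys f = sym (+-identityˡ _)
    ∑-++ (x ∷ xs) ys f = trans (+-congˡ (∑-++ xs ys f)) (sym (+-assoc _ _ _))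

    ∑-0# : ∀ (xs : List A) → ∑ xs (λ _ → 0#) ≈ 0#
    ∑-0# []       = refl
    ∑-0# (x ∷ xs) = trans (+-identityˡ _) (∑-0# xs)

    ∑-+ : ∀ (xs : List A) f g → ∑ xs (λ x → f x + g x) ≈ ∑ xs f + ∑ xs g
    ∑-+ []       f g = sym (+-identityˡ _)
    ∑-+ (x ∷ xs) f g = begin
      (f x + g x) + ∑ xs (λ x → f x + g x) ≈⟨ +-congˡ (∑-+ xs f g) ⟩
      (f x + g x) + (∑ xs f + ∑ xs g)      ≈⟨ +-interchange _ _ _ _ ⟩
      (f x + ∑ xs f) + (g x + ∑ xs g)      ∎

    *-distribˡ-∑ : ∀ (xs : List A) k f → k * ∑ xs f ≈ ∑ xs (λ x → k * f x)
    *-distribˡ-∑ []       k f = zeroʳ k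
    *-distribˡ-∑ (x ∷ xs) k f = trans (distribˡ _ _ _) (+-congˡ (*-distribˡ-∑ xs k f))

  ∑-map : ∀ {a b} {A : Set a} {B : Set b} (g : A → B) (xs : List A) f → ∑ (map g xs) f ≡ ∑ xs (f ∘ g)
  ∑-map g []       f = ≡.refl
  ∑-map g (x ∷ xs) f = ≡.cong (f (g x) +_) (∑-map g xs f)

  ∑-concatMap : ∀ {a b} {A : Set a} {B : Set b} (h : A → List B) (xs : List A) f →
                ∑ (concatMap h xs) f ≈ ∑ xs (λ x → ∑ (h x) f)
  ∑-concatMap h []       f = refl
  ∑-concatMap h (x ∷ xs) f = trans (∑-++ (h x) (concatMap h xs) f) (+-congˡ (∑-concatMap h xs f))

  ∑-comm : ∀ {a b} {A : Set a} {B : Set b} (xs : List A) (ys : List B) (f : A → B → Carrier) →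
           ∑ xs (λ x → ∑ ys (f x)) ≈ ∑ ys (λ y → ∑ xs (λ x → f x y))
  ∑-comm []       ys f = sym (∑-0# ys)
  ∑-comm (x ∷ xs) ys f = trans (+-congˡ (∑-comm xs ys f)) (sym (∑-+ ys (f x) _))

  ⟦_⟧ : ∀ {a} {A : Set a} → List (Carrier × A) → (A → Carrier) → Carrier
  ⟦ p ⟧ G = ∑ p (λ (a , x) → a * G x)

  module _ {a} {A : Set a} where

    ⟦⟧-cong : ∀ (p : List (Carrier × A)) {G H : A → Carrier} → (∀ x → G x ≈ H x) → ⟦ p ⟧ G ≈ ⟦ p ⟧ H
    ⟦⟧-cong p eq = ∑-cong p (λ t → *-congˡ (eq (proj₂ t)))

    ⟦⟧-congᴬ : ∀ {P : A → Set} (p : List (Carrier × A)) → All (P ∘ proj₂) p →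
               {G H : A → Carrier} → (∀ x → P x → G x ≈ H x) → ⟦ p ⟧ G ≈ ⟦ p ⟧ H
    ⟦⟧-congᴬ []      []        eq = refl
    ⟦⟧-congᴬ (t ∷ p) (Pt ∷ Pp) eq = +-cong (*-congˡ (eq _ Pt)) (⟦⟧-congᴬ p Pp eq)

    ⟦⟧-+ : ∀ (p : List (Carrier × A)) G H → ⟦ p ⟧ (λ x → G x + H x) ≈ ⟦ p ⟧ G + ⟦ p ⟧ H
    ⟦⟧-+ p G H = trans (∑-cong p (λ t → distribˡ _ _ _)) (∑-+ p _ _)

    ⟦⟧-* : ∀ (p : List (Carrier × A)) k G → ⟦ p ⟧ (λ x → k * G x) ≈ k * ⟦ p ⟧ G
    ⟦⟧-* p k G = trans (∑-cong p (λ t → x*yz≈y*xz _ _ _)) (sym (*-distribˡ-∑ p k _))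

    ⟦⟧-∑ : ∀ {b} {B : Set b} (p : List (Carrier × A)) (ys : List B) (f : A → B → Carrier) →
           ⟦ p ⟧ (λ x → ∑ ys (f x)) ≈ ∑ ys (λ y → ⟦ p ⟧ (λ x → f x y))
    ⟦⟧-∑ p ys f = trans (∑-cong p (λ t → *-distribˡ-∑ ys (proj₁ t) _)) (∑-comm p ys _)

  ⟦⟧-comm : ∀ {a b} {A : Set a} {B : Set b} (p : List (Carrier × A)) (q : List (Carrier × B)) (f : A → B → Carrier) →
            ⟦ p ⟧ (λ x → ⟦ q ⟧ (f x)) ≈ ⟦ q ⟧ (λ y → ⟦ p ⟧ (λ x → f x y))
  ⟦⟧-comm p q f = trans (⟦⟧-∑ p q _) (∑-cong q (λ t → ⟦⟧-* p (proj₁ t) _))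

  ⟦⟧-map : ∀ {a b} {A : Set a} {B : Set b} (g : A → B) (p : List (Carrier × A)) G →
           ⟦ map (λ (a , x) → a , g x) p ⟧ G ≡ ⟦ p ⟧ (G ∘ g)
  ⟦⟧-map g p G = ∑-map _ p _

  δ : Word R → Word R → Carrier
  δ w u with ≡-dec ℕ._≟_ u w
  ... | yes _ = 1#
  ... | no  _ = 0#

  δ-refl : ∀ u → δ u u ≈ 1#
  δ-refl u with ≡-dec ℕ._≟_ u u
  ... | yes _  = refl
  ... | no u≢u = ⊥-elim (u≢u ≡.refl)

  δ-≢ : ∀ {w u} → u ≢ w → δ w u ≈ 0#
  δ-≢ {w} {u} u≢w with ≡-dec ℕ._≟_ u w
  ... | yes u≡w = ⊥-elim (u≢w u≡w)
  ... | no  _   = refl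

  coeff-∷ : ∀ w a u (p : Poly R) → coeff R w ((a , u) ∷ p) ≈ a * δ w u + coeff R w p
  coeff-∷ w a u p with ≡-dec ℕ._≟_ u w
  ... | yes _ = +-congʳ (sym (*-identityʳ a))
  ... | no  _ = sym (trans (+-congʳ (zeroʳ a)) (+-identityˡ _))

  coeff≈⟦⟧δ : ∀ w (p : Poly R) → coeff R w p ≈ ⟦ p ⟧ (δ w)
  coeff≈⟦⟧δ w []            = refl
  coeff≈⟦⟧δ w ((a , u) ∷ p) = trans (coeff-∷ w a u p) (+-congˡ (coeff≈⟦⟧δ w p))

  ⟦⟧⇒≈P : ∀ (p q : Poly R) → (∀ G → ⟦ p ⟧ G ≈ ⟦ q ⟧ G) → _≈P_ R p q
  ⟦⟧⇒≈P p q eq w = trans (coeff≈⟦⟧δ w p) (trans (eq (δ w)) (sym (coeff≈⟦⟧δ w q)))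

  ∑-δ : ∀ (G : Word R → Carrier) {u} (ws : List (Word R)) → Unique ws → u ∈ ws → ∑ ws (λ w → G w * δ w u) ≈ G u
  ∑-δ G {u} (.u ∷ ws) (u∉ws ∷ _) (here ≡.refl) = begin
    G u * δ u u + ∑ ws (λ w → G w * δ w u) ≈⟨ +-cong (trans (*-congˡ (δ-refl u)) (*-identityʳ _)) (∑-congᴬ ws {g = λ _ → 0#} δ-vanishes) ⟩
    G u + ∑ ws (λ _ → 0#)                 ≈⟨ trans (+-congˡ (∑-0# ws)) (+-identityʳ _) ⟩
    G u                                   ∎
    where
    δ-vanishes : All (λ w → G w * δ w u ≈ 0#) ws
    δ-vanishes = All.map (λ u≢w → trans (*-congˡ (δ-≢ u≢w)) (zeroʳ _)) u∉ws
    ∑-congᴬ : ∀ (xs : List (Word R)) {f g : Word R → Carrier} → All (λ x → f x ≈ g x) xs → ∑ xs f ≈ ∑ xs g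
    ∑-congᴬ []       []         = refl
    ∑-congᴬ (x ∷ xs) (e ∷ es) = +-cong e (∑-congᴬ xs es)
  ∑-δ G {u} (v ∷ ws) (v∉ws ∷ uniq) (there u∈ws) = begin
    G v * δ v u + ∑ ws (λ w → G w * δ w u)
      ≈⟨ +-cong (trans (*-congˡ (δ-≢ (λ u≡v → All.lookup v∉ws u∈ws (≡.sym u≡v)))) (zeroʳ _)) (∑-δ G ws uniq u∈ws) ⟩
    0# + G u                               ≈⟨ +-identityˡ _ ⟩
    G u                                    ∎

  ⟦⟧-via-coeff : ∀ G (ws : List (Word R)) → Unique ws → ∀ (p : Poly R) →
                 (∀ {t} → t ∈ p → proj₂ t ∈ ws) → ⟦ p ⟧ G ≈ ∑ ws (λ w → G w * coeff R w p)
  ⟦⟧-via-coeff G ws uniq [] _ = sym (trans (∑-cong ws (λ w → zeroʳ _)) (∑-0# ws))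
  ⟦⟧-via-coeff G ws uniq ((a , u) ∷ p) ⊆ws = begin
    a * G u + ⟦ p ⟧ G
      ≈⟨ +-cong (*-congˡ (sym (∑-δ G ws uniq (⊆ws (here ≡.refl))))) (⟦⟧-via-coeff G ws uniq p (⊆ws ∘ there)) ⟩
    a * ∑ ws (λ w → G w * δ w u) + ∑ ws (λ w → G w * coeff R w p)
      ≈⟨ +-congʳ (*-distribˡ-∑ ws a _) ⟩
    ∑ ws (λ w → a * (G w * δ w u)) + ∑ ws (λ w → G w * coeff R w p)
      ≈⟨ sym (∑-+ ws _ _) ⟩
    ∑ ws (λ w → a * (G w * δ w u) + G w * coeff R w p)
      ≈⟨ ∑-cong ws (λ w → trans (+-congʳ (x*yz≈y*xz _ _ _)) (sym (distribˡ _ _ _))) ⟩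
    ∑ ws (λ w → G w * (a * δ w u + coeff R w p))
      ≈⟨ ∑-cong ws (λ w → *-congˡ (sym (coeff-∷ w a u p))) ⟩
    ∑ ws (λ w → G w * coeff R w ((a , u) ∷ p)) ∎

  ≈P⇒⟦⟧ : ∀ (p q : Poly R) → _≈P_ R p q → ∀ G → ⟦ p ⟧ G ≈ ⟦ q ⟧ G
  ≈P⇒⟦⟧ p q p≈q G = begin
    ⟦ p ⟧ G                        ≈⟨ ⟦⟧-via-coeff G ws uniq p (λ t∈p → ∈-deduplicate⁺ _ (∈-map⁺ proj₂ (∈-++⁺ˡ t∈p))) ⟩
    ∑ ws (λ w → G w * coeff R w p) ≈⟨ ∑-cong ws (λ w → *-congˡ (p≈q w)) ⟩
    ∑ ws (λ w → G w * coeff R w q) ≈⟨ sym (⟦⟧-via-coeff G ws uniq q (λ t∈q → ∈-deduplicate⁺ _ (∈-map⁺ proj₂ (∈-++⁺ʳ p t∈q)))) ⟩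
    ⟦ q ⟧ G                        ∎
    where
    ws   = deduplicate (≡-dec ℕ._≟_) (map proj₂ (p ++ q))
    uniq = deduplicate-! (≡-dec ℕ._≟_) (map proj₂ (p ++ q))

  ⟦ι⟧ : ∀ {n} (p : NMI R n) G → ⟦ ι R p ⟧ G ≡ ⟦ p ⟧ (G ∘ toList)
  ⟦ι⟧ p G = ⟦⟧-map toList p G

  ⟦·⟧ : ∀ {n} a (p : NMI R n) H → ⟦ _·_ R a p ⟧ H ≈ a * ⟦ p ⟧ H
  ⟦·⟧ a p H = begin
    ∑ (map _ p) _                           ≡⟨ ∑-map _ p _ ⟩
    ∑ p (λ (b , x) → (a * b) * H x)         ≈⟨ ∑-cong p (λ t → *-assoc _ _ _) ⟩
    ∑ p (λ (b , x) → a * (b * H x))         ≈⟨ sym (*-distribˡ-∑ p a _) ⟩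
    a * ⟦ p ⟧ H                             ∎

  ⟦mul⟧ : ∀ {n k} (p : NMI R n) (q : NMI R k) H →
          ⟦ mul R p q ⟧ H ≈ ⟦ p ⟧ (λ x → ⟦ q ⟧ (λ y → H (x Vec.++ y)))
  ⟦mul⟧ p q H = begin
    ⟦ mul R p q ⟧ H                                              ≈⟨ ∑-concatMap _ p _ ⟩
    ∑ p (λ s → ∑ (map _ q) _)                                    ≈⟨ ∑-cong p (λ s → reflexive (∑-map _ q _)) ⟩
    ∑ p (λ (a , x) → ∑ q (λ (b , y) → (a * b) * H (x Vec.++ y))) ≈⟨ ∑-cong p (λ s → trans (∑-cong q (λ t → *-assoc _ _ _)) (sym (*-distribˡ-∑ q _ _))) ⟩
    ⟦ p ⟧ (λ x → ⟦ q ⟧ (λ y → H (x Vec.++ y)))                   ∎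

  -- The transpose of D on test functions

  ∂ᵛ : ∀ {n} → (Vec ℕ n → Carrier) → Vec ℕ n → Carrier
  ∂ᵛ H x = ∑ (Dword R x) H

  ∂ᵛ^ : ∀ {n} → ℕ → (Vec ℕ n → Carrier) → Vec ℕ n → Carrier
  ∂ᵛ^ zero    H = H
  ∂ᵛ^ (suc i) H = ∂ᵛ^ i (∂ᵛ H)

  ∂ᵛ^-cong : ∀ {n} i {H H′ : Vec ℕ n → Carrier} → (∀ y → H y ≈ H′ y) → ∀ x → ∂ᵛ^ i H x ≈ ∂ᵛ^ i H′ x
  ∂ᵛ^-cong zero    eq = eq
  ∂ᵛ^-cong (suc i) eq = ∂ᵛ^-cong i (λ x → ∑-cong (Dword R x) eq)

  ⟦D⟧ : ∀ {n} (p : NMI R n) H → ⟦ D R p ⟧ H ≈ ⟦ p ⟧ (∂ᵛ H)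
  ⟦D⟧ p H = begin
    ⟦ D R p ⟧ H                                         ≈⟨ ∑-concatMap _ p _ ⟩
    ∑ p (λ (a , x) → ∑ (map (a ,_) (Dword R x)) _)      ≈⟨ ∑-cong p (λ (a , x) → reflexive (∑-map _ (Dword R x) _)) ⟩
    ∑ p (λ (a , x) → ∑ (Dword R x) (λ y → a * H y))     ≈⟨ ∑-cong p (λ (a , x) → sym (*-distribˡ-∑ (Dword R x) a H)) ⟩
    ⟦ p ⟧ (∂ᵛ H)                                        ∎

  ⟦D^⟧ : ∀ {n} i (p : NMI R n) H → ⟦ D^ R i p ⟧ H ≈ ⟦ p ⟧ (∂ᵛ^ i H)
  ⟦D^⟧ zero    p H = refl
  ⟦D^⟧ (suc i) p H = trans (⟦D⟧ (D^ R i p) H) (⟦D^⟧ i p (∂ᵛ H))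

  Dwordˡ : Word R → List (Word R)
  Dwordˡ []      = []
  Dwordˡ (i ∷ u) = (suc i ∷ u) ∷ map (i ∷_) (Dwordˡ u)

  ∂ : (Word R → Carrier) → Word R → Carrier
  ∂ G u = ∑ (Dwordˡ u) G

  ∂^ : ℕ → (Word R → Carrier) → Word R → Carrier
  ∂^ zero    G = G
  ∂^ (suc i) G = ∂^ i (∂ G)

  map-toList-Dword : ∀ {n} (x : Vec ℕ n) → map toList (Dword R x) ≡ Dwordˡ (toList x)
  map-toList-Dword []      = ≡.refl
  map-toList-Dword (i ∷ x) = ≡.cong ((suc i ∷ toList x) ∷_)
    (≡.trans (≡.sym (List.map-∘ (Dword R x)))
      (≡.trans (List.map-∘ (Dword R x)) (≡.cong (map (i ∷_)) (map-toList-Dword x))))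

  ∂ᵛ^-toList : ∀ {n} i (G : Word R → Carrier) (x : Vec ℕ n) → ∂ᵛ^ i (G ∘ toList) x ≈ ∂^ i G (toList x)
  ∂ᵛ^-toList zero    G x = refl
  ∂ᵛ^-toList (suc i) G x = trans (∂ᵛ^-cong i ∂ᵛ-toList x) (∂ᵛ^-toList i (∂ G) x)
    where
    ∂ᵛ-toList : ∀ y → ∂ᵛ (G ∘ toList) y ≈ ∂ G (toList y)
    ∂ᵛ-toList y = reflexive (≡.trans (≡.sym (∑-map toList (Dword R y) G)) (≡.cong (λ ws → ∑ ws G) (map-toList-Dword y)))

  ⟦ιD^⟧ : ∀ {n} i (q : NMI R n) G → ⟦ ι R (D^ R i q) ⟧ G ≈ ⟦ ι R q ⟧ (∂^ i G)
  ⟦ιD^⟧ i q G = begin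
    ⟦ ι R (D^ R i q) ⟧ G          ≡⟨ ⟦ι⟧ (D^ R i q) G ⟩
    ⟦ D^ R i q ⟧ (G ∘ toList)     ≈⟨ ⟦D^⟧ i q _ ⟩
    ⟦ q ⟧ (∂ᵛ^ i (G ∘ toList))    ≈⟨ ⟦⟧-cong q (∂ᵛ^-toList i G) ⟩
    ⟦ q ⟧ (∂^ i G ∘ toList)       ≡⟨ ≡.sym (⟦ι⟧ q _) ⟩
    ⟦ ι R q ⟧ (∂^ i G)            ∎

  ⟦_⟧ⁿ : ∀ {n} → (Fin n → Poly R) → (Vec (Word R) n → Carrier) → Carrier
  ⟦_⟧ⁿ {zero}  L K = K []
  ⟦_⟧ⁿ {suc n} L K = ⟦ L zero ⟧ (λ u → ⟦ L ∘ suc ⟧ⁿ (λ us → K (u ∷ us)))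

  ⟦⟧ⁿ-cong : ∀ {n} (L : Fin n → Poly R) {K K′ : Vec (Word R) n → Carrier} → (∀ us → K us ≈ K′ us) → ⟦ L ⟧ⁿ K ≈ ⟦ L ⟧ⁿ K′
  ⟦⟧ⁿ-cong {zero}  L eq = eq []
  ⟦⟧ⁿ-cong {suc n} L eq = ⟦⟧-cong (L zero) (λ u → ⟦⟧ⁿ-cong (L ∘ suc) (λ us → eq (u ∷ us)))

  ⟦⟧ⁿ-congᴬ : ∀ {n} (L : Fin n → Poly R) (P : Fin n → Word R → Set) → (∀ j → All (P j ∘ proj₂) (L j)) →
              {K K′ : Vec (Word R) n → Carrier} → (∀ us → (∀ j → P j (lookup us j)) → K us ≈ K′ us) → ⟦ L ⟧ⁿ K ≈ ⟦ L ⟧ⁿ K′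
  ⟦⟧ⁿ-congᴬ {zero}  L P PL eq = eq [] (λ ())
  ⟦⟧ⁿ-congᴬ {suc n} L P PL eq = ⟦⟧-congᴬ (L zero) (PL zero) (λ u Pu →
    ⟦⟧ⁿ-congᴬ (L ∘ suc) (P ∘ suc) (PL ∘ suc) (λ us Pus → eq (u ∷ us) (λ { zero → Pu ; (suc j) → Pus j })))

  ⟦⟧ⁿ-pointwise : ∀ {n} (L L′ : Fin n → Poly R) → (∀ j G → ⟦ L j ⟧ G ≈ ⟦ L′ j ⟧ G) → ∀ K → ⟦ L ⟧ⁿ K ≈ ⟦ L′ ⟧ⁿ K
  ⟦⟧ⁿ-pointwise {zero}  L L′ eq K = refl
  ⟦⟧ⁿ-pointwise {suc n} L L′ eq K =
    trans (⟦⟧-cong (L zero) (λ u → ⟦⟧ⁿ-pointwise (L ∘ suc) (L′ ∘ suc) (eq ∘ suc) _)) (eq zero _)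

  ⟦⟧ⁿ-≡ : ∀ {n} (L L′ : Fin n → Poly R) → (∀ j → L j ≡ L′ j) → ∀ K → ⟦ L ⟧ⁿ K ≈ ⟦ L′ ⟧ⁿ K
  ⟦⟧ⁿ-≡ L L′ eq = ⟦⟧ⁿ-pointwise L L′ (λ j G → reflexive (≡.cong (λ l → ⟦ l ⟧ G) (eq j)))

  ⟦⟧ⁿ-+ : ∀ {n} (L : Fin n → Poly R) K K′ → ⟦ L ⟧ⁿ (λ us → K us + K′ us) ≈ ⟦ L ⟧ⁿ K + ⟦ L ⟧ⁿ K′
  ⟦⟧ⁿ-+ {zero}  L K K′ = refl
  ⟦⟧ⁿ-+ {suc n} L K K′ = trans (⟦⟧-cong (L zero) (λ u → ⟦⟧ⁿ-+ (L ∘ suc) _ _)) (⟦⟧-+ (L zero) _ _)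

  ⟦⟧ⁿ-∑ : ∀ {n b} {B : Set b} (L : Fin n → Poly R) (ys : List B) (f : Vec (Word R) n → B → Carrier) →
          ⟦ L ⟧ⁿ (λ us → ∑ ys (f us)) ≈ ∑ ys (λ y → ⟦ L ⟧ⁿ (λ us → f us y))
  ⟦⟧ⁿ-∑ {zero}  L ys f = refl
  ⟦⟧ⁿ-∑ {suc n} L ys f = trans (⟦⟧-cong (L zero) (λ u → ⟦⟧ⁿ-∑ (L ∘ suc) ys _)) (⟦⟧-∑ (L zero) ys _)

  ⟦⟧-⟦⟧ⁿ-comm : ∀ {n} (p : Poly R) (L : Fin n → Poly R) (X : Word R → Vec (Word R) n → Carrier) →
                ⟦ p ⟧ (λ u → ⟦ L ⟧ⁿ (X u)) ≈ ⟦ L ⟧ⁿ (λ vs → ⟦ p ⟧ (λ u → X u vs))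
  ⟦⟧-⟦⟧ⁿ-comm {zero}  p L X = refl
  ⟦⟧-⟦⟧ⁿ-comm {suc n} p L X = trans (⟦⟧-comm p (L zero) _) (⟦⟧-cong (L zero) (λ v → ⟦⟧-⟦⟧ⁿ-comm p (L ∘ suc) _))

  ⟦⟧ⁿ-comm : ∀ {n k} (L : Fin n → Poly R) (L′ : Fin k → Poly R) (X : Vec (Word R) n → Vec (Word R) k → Carrier) →
             ⟦ L ⟧ⁿ (λ us → ⟦ L′ ⟧ⁿ (X us)) ≈ ⟦ L′ ⟧ⁿ (λ vs → ⟦ L ⟧ⁿ (λ us → X us vs))
  ⟦⟧ⁿ-comm {zero}  L L′ X = refl
  ⟦⟧ⁿ-comm {suc n} L L′ X = trans (⟦⟧-cong (L zero) (λ u → ⟦⟧ⁿ-comm (L ∘ suc) L′ _)) (⟦⟧-⟦⟧ⁿ-comm (L zero) L′ _)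

  ⟦⟧ⁿ-map : ∀ {n} (L L′ : Fin n → Poly R) (g : Fin n → Word R → Word R) → (∀ j G → ⟦ L j ⟧ G ≈ ⟦ L′ j ⟧ (G ∘ g j)) →
            ∀ K → ⟦ L ⟧ⁿ K ≈ ⟦ L′ ⟧ⁿ (λ us → K (tabulate g ⊛ us))
  ⟦⟧ⁿ-map {zero}  L L′ g eq K = refl
  ⟦⟧ⁿ-map {suc n} L L′ g eq K =
    trans (⟦⟧-cong (L zero) (λ u → ⟦⟧ⁿ-map (L ∘ suc) (L′ ∘ suc) (g ∘ suc) (eq ∘ suc) _)) (eq zero _)

  ⟦⟧ⁿ-++ : ∀ a {b} (L : Fin (a ℕ.+ b) → Poly R) K →
           ⟦ L ⟧ⁿ K ≈ ⟦ (λ i → L (i ↑ˡ b)) ⟧ⁿ (λ us → ⟦ (λ i → L (a ↑ʳ i)) ⟧ⁿ (λ vs → K (us Vec.++ vs)))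
  ⟦⟧ⁿ-++ zero    L K = refl
  ⟦⟧ⁿ-++ (suc a) L K = ⟦⟧-cong (L zero) (λ u → ⟦⟧ⁿ-++ a (L ∘ suc) _)

  ⟦⟧ⁿ-pull : ∀ {n} (L : Fin (suc n) → Poly R) (j : Fin (suc n)) K →
             ⟦ L ⟧ⁿ K ≈ ⟦ L j ⟧ (λ u → ⟦ L ∘ punchIn j ⟧ⁿ (λ vs → K (insertAt vs j u)))
  ⟦⟧ⁿ-pull         L zero    K = refl
  ⟦⟧ⁿ-pull {suc n} L (suc j) K =
    trans (⟦⟧-cong (L zero) (λ u₀ → ⟦⟧ⁿ-pull (L ∘ suc) j (λ us → K (u₀ ∷ us)))) (⟦⟧-comm (L zero) (L (suc j)) _)

  ⟦⟧ⁿ-permute : ∀ {n} (L : Fin n → Poly R) (σ : Permutation′ n) K →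
                ⟦ (λ k → L (σ ⟨$⟩ʳ k)) ⟧ⁿ K ≈ ⟦ L ⟧ⁿ (K ∘ permute σ)
  ⟦⟧ⁿ-permute {zero}  L σ K = refl
  ⟦⟧ⁿ-permute {suc n} L σ K = begin
    ⟦ L j ⟧ (λ u → ⟦ (λ k → L (σ ⟨$⟩ʳ suc k)) ⟧ⁿ (λ vs → K (u ∷ vs)))
      ≈⟨ ⟦⟧-cong (L j) (λ u → ⟦⟧ⁿ-≡ _ _ (λ k → ≡.cong L (punchIn-permute σ zero k)) _) ⟩
    ⟦ L j ⟧ (λ u → ⟦ (λ k → L (punchIn j (σ′ ⟨$⟩ʳ k))) ⟧ⁿ (λ vs → K (u ∷ vs)))
      ≈⟨ ⟦⟧-cong (L j) (λ u → ⟦⟧ⁿ-permute (L ∘ punchIn j) σ′ (λ vs → K (u ∷ vs))) ⟩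
    ⟦ L j ⟧ (λ u → ⟦ L ∘ punchIn j ⟧ⁿ (λ vs → K (u ∷ permute σ′ vs)))
      ≈⟨ ⟦⟧-cong (L j) (λ u → ⟦⟧ⁿ-cong (L ∘ punchIn j) (λ vs → reflexive (≡.cong K (∷-permute u vs)))) ⟩
    ⟦ L j ⟧ (λ u → ⟦ L ∘ punchIn j ⟧ⁿ (λ vs → K (permute σ (insertAt vs j u))))
      ≈⟨ sym (⟦⟧ⁿ-pull L j (K ∘ permute σ)) ⟩
    ⟦ L ⟧ⁿ (K ∘ permute σ) ∎
    where
    j  = σ ⟨$⟩ʳ zero
    σ′ = remove zero σ
    ∷-permute : ∀ u vs → u ∷ permute σ′ vs ≡ permute σ (insertAt vs j u)
    ∷-permute u vs = lookup-ext (u ∷ permute σ′ vs) (permute σ (insertAt vs j u)) λ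
      { zero    → ≡.sym (≡.trans (Vec.lookup∘tabulate slots zero) (Vec.insertAt-lookup vs j u))
      ; (suc k) → ≡.sym (≡.trans (Vec.lookup∘tabulate slots (suc k))
                  (≡.trans (≡.cong (lookup (insertAt vs j u)) (punchIn-permute σ zero k))
                  (≡.trans (Vec.insertAt-punchIn vs j u (σ′ ⟨$⟩ʳ k)) (≡.sym (Vec.lookup∘tabulate (lookup vs ∘ (σ′ ⟨$⟩ʳ_)) k))))) }
      where slots = lookup (insertAt vs j u) ∘ (σ ⟨$⟩ʳ_)

  ⟦⟧ⁿ-point : ∀ {n} (L : Fin n → Poly R) (ws : Fin n → Word R) → (∀ j G → ⟦ L j ⟧ G ≈ G (ws j)) →
              ∀ K → ⟦ L ⟧ⁿ K ≈ K (tabulate ws)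
  ⟦⟧ⁿ-point {zero}  L ws eq K = refl
  ⟦⟧ⁿ-point {suc n} L ws eq K = trans (⟦⟧-cong (L zero) (λ u → ⟦⟧ⁿ-point (L ∘ suc) (ws ∘ suc) (eq ∘ suc) _)) (eq zero _)

  ⟦ιprodF⟧ : ∀ {n} {m : Fin n → ℕ} (P : (j : Fin n) → NMI R (m j)) G →
             ⟦ ι R (prodF R P) ⟧ G ≈ ⟦ ι R ∘ P ⟧ⁿ (G ∘ concatWords)
  ⟦ιprodF⟧ {zero}  P G = trans (+-identityʳ _) (*-identityˡ _)
  ⟦ιprodF⟧ {suc n} P G = begin
    ⟦ ι R (prodF R P) ⟧ G
      ≡⟨ ⟦ι⟧ (prodF R P) G ⟩
    ⟦ mul R (P zero) (prodF R (P ∘ suc)) ⟧ (G ∘ toList)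
      ≈⟨ ⟦mul⟧ (P zero) _ _ ⟩
    ⟦ P zero ⟧ (λ x → ⟦ prodF R (P ∘ suc) ⟧ (λ y → G (toList (x Vec.++ y))))
      ≈⟨ ⟦⟧-cong (P zero) (λ x → ⟦⟧-cong (prodF R (P ∘ suc)) (λ y → reflexive (≡.cong G (Vec.toList-++ x y)))) ⟩
    ⟦ P zero ⟧ (λ x → ⟦ prodF R (P ∘ suc) ⟧ (λ y → G (toList x ++ toList y)))
      ≈⟨ ⟦⟧-cong (P zero) (λ x → trans (reflexive (≡.sym (⟦ι⟧ (prodF R (P ∘ suc)) _))) (⟦ιprodF⟧ (P ∘ suc) (λ v → G (toList x ++ v)))) ⟩
    ⟦ P zero ⟧ (λ x → ⟦ ι R ∘ P ∘ suc ⟧ⁿ (λ us → G (toList x ++ concatWords us)))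
      ≡⟨ ≡.sym (⟦ι⟧ (P zero) _) ⟩
    ⟦ ι R ∘ P ⟧ⁿ (G ∘ concatWords) ∎

  -- The composite X_{e 1} ⋯ X_{e n} ∘ (r_1, …, r_n) paired with G, where E k i plays the role of D^i(r_k)
  evalComp : ∀ {n} → (Fin n → ℕ) → (Fin n → ℕ → Poly R) → (Word R → Carrier) → Carrier
  evalComp e E G = ⟦ (λ k → E k (e k)) ⟧ⁿ (G ∘ concatWords)

  derivs : ∀ {n} {l : Fin n → ℕ} → ((k : Fin n) → NMI R (l k)) → Fin n → ℕ → Poly R
  derivs r k i = ι R (D^ R i (r k))

  ⟦ιγ⟧ : ∀ {n} {m : Fin n → ℕ} (p : NMI R n) (q : (j : Fin n) → NMI R (m j)) G →
         ⟦ ι R (γ R p q) ⟧ G ≈ ⟦ p ⟧ (λ x → evalComp (lookup x) (derivs q) G)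
  ⟦ιγ⟧ p q G = begin
    ⟦ ι R (γ R p q) ⟧ G                                                    ≡⟨ ⟦ι⟧ (γ R p q) G ⟩
    ⟦ γ R p q ⟧ (G ∘ toList)                                               ≈⟨ ∑-concatMap _ p _ ⟩
    ∑ p (λ (a , x) → ⟦ _·_ R a (compWord R x q) ⟧ (G ∘ toList))            ≈⟨ ∑-cong p (λ (a , x) → ⟦·⟧ a (compWord R x q) _) ⟩
    ∑ p (λ (a , x) → a * ⟦ compWord R x q ⟧ (G ∘ toList))                  ≈⟨ ∑-cong p (λ (a , x) → *-congˡ (compWord-eval x)) ⟩
    ⟦ p ⟧ (λ x → evalComp (lookup x) (derivs q) G)                         ∎
    where
    compWord-eval : ∀ x → ⟦ compWord R x q ⟧ (G ∘ toList) ≈ evalComp (lookup x) (derivs q) G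
    compWord-eval x = trans (reflexive (≡.sym (⟦ι⟧ (compWord R x q) G))) (⟦ιprodF⟧ (λ j → D^ R (lookup x j) (q j)) G)

  ⟦⟧⇒≈N : ∀ {n k} (p : NMI R n) (p′ : NMI R k) → (∀ G → ⟦ ι R p ⟧ G ≈ ⟦ ι R p′ ⟧ G) → _≈N_ R p p′
  ⟦⟧⇒≈N p p′ = ⟦⟧⇒≈P (ι R p) (ι R p′)

  ⟦⟧-toVec : ∀ {n} (p : NMI R n) H → ⟦ p ⟧ H ≈ ⟦ ι R p ⟧ (H ∘ toVec)
  ⟦⟧-toVec p H = trans (⟦⟧-cong p (λ x → reflexive (≡.cong H (≡.sym (toVec-toList x))))) (reflexive (≡.sym (⟦ι⟧ p _)))

  ≈N⇒⟦⟧ : ∀ {n} (p p′ : NMI R n) → _≈N_ R p p′ → ∀ H → ⟦ p ⟧ H ≈ ⟦ p′ ⟧ H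
  ≈N⇒⟦⟧ p p′ p≈p′ H = trans (⟦⟧-toVec p H) (trans (≈P⇒⟦⟧ (ι R p) (ι R p′) p≈p′ _) (sym (⟦⟧-toVec p′ H)))

  ⟦ιact⟧ : ∀ {N N′} (f : Fin N′ → Fin N) (p : NMI R N) G →
           ⟦ ι R (act R f p) ⟧ G ≡ ⟦ p ⟧ (λ x → G (toList (tabulate (lookup x ∘ f))))
  ⟦ιact⟧ f p G = ≡.trans (⟦ι⟧ (act R f p) G) (⟦⟧-map _ p _)

  ^-cong : ∀ {n} (p p′ : NMI R n) (σ : Permutation′ n) → _≈N_ R p p′ → _≈N_ R (_^_ R p σ) (_^_ R p′ σ)
  ^-cong p p′ σ p≈p′ = ⟦⟧⇒≈N (_^_ R p σ) (_^_ R p′ σ) (λ G → begin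
    ⟦ ι R (_^_ R p σ) ⟧ G                                  ≡⟨ ⟦ιact⟧ _ p G ⟩
    ⟦ p ⟧ (λ x → G (toList (permute σ x)))                 ≈⟨ ≈N⇒⟦⟧ p p′ p≈p′ _ ⟩
    ⟦ p′ ⟧ (λ x → G (toList (permute σ x)))                ≡⟨ ≡.sym (⟦ιact⟧ _ p′ G) ⟩
    ⟦ ι R (_^_ R p′ σ) ⟧ G                                 ∎)

  ^-idₚ : ∀ {n} (p : NMI R n) → _≈N_ R (_^_ R p idₚ) p
  ^-idₚ p = ⟦⟧⇒≈N (_^_ R p idₚ) p (λ G → begin
    ⟦ ι R (_^_ R p idₚ) ⟧ G                         ≡⟨ ⟦ιact⟧ _ p G ⟩
    ⟦ p ⟧ (λ x → G (toList (tabulate (lookup x))))  ≈⟨ ⟦⟧-cong p (λ x → reflexive (≡.cong (G ∘ toList) (Vec.tabulate∘lookup x))) ⟩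
    ⟦ p ⟧ (G ∘ toList)                              ≡⟨ ≡.sym (⟦ι⟧ p G) ⟩
    ⟦ ι R p ⟧ G                                     ∎)

  ^-∘ₚ : ∀ {n} (p : NMI R n) (σ τ : Permutation′ n) → _≈N_ R (_^_ R (_^_ R p σ) τ) (_^_ R p (τ ∘ₚ σ))
  ^-∘ₚ p σ τ = ⟦⟧⇒≈N (_^_ R (_^_ R p σ) τ) (_^_ R p (τ ∘ₚ σ)) (λ G → begin
    ⟦ ι R (_^_ R (_^_ R p σ) τ) ⟧ G                     ≡⟨ ≡.trans (⟦ιact⟧ _ (_^_ R p σ) G) (⟦⟧-map _ p _) ⟩
    ⟦ p ⟧ (λ x → G (toList (permute τ (permute σ x))))  ≈⟨ ⟦⟧-cong p (λ x → reflexive (≡.cong (G ∘ toList) (permute-∘ x))) ⟩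
    ⟦ p ⟧ (λ x → G (toList (permute (τ ∘ₚ σ) x)))       ≡⟨ ≡.sym (⟦ιact⟧ _ p G) ⟩
    ⟦ ι R (_^_ R p (τ ∘ₚ σ)) ⟧ G                        ∎)
    where
    permute-∘ : ∀ x → permute τ (permute σ x) ≡ permute (τ ∘ₚ σ) x
    permute-∘ x = Vec.tabulate-cong (λ k → Vec.lookup∘tabulate (lookup x ∘ (σ ⟨$⟩ʳ_)) (τ ⟨$⟩ʳ k))

  D^-unit : ∀ i → D^ R i (unit R) ≡ (1# , i ∷ []) ∷ []
  D^-unit zero    = ≡.refl
  D^-unit (suc i) = ≡.cong (D R) (D^-unit i)

  γ-identityˡ : ∀ (m : Fin 1 → ℕ) (q : (j : Fin 1) → NMI R (m j)) → _≈N_ R (γ R (unit R) q) (q zero)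
  γ-identityˡ m q = ⟦⟧⇒≈N (γ R (unit R) q) (q zero) (λ G → begin
    ⟦ ι R (γ R (unit R) q) ⟧ G                      ≈⟨ ⟦ιγ⟧ (unit R) q G ⟩
    1# * ⟦ ι R (q zero) ⟧ (λ u → G (u ++ [])) + 0#  ≈⟨ trans (+-identityʳ _) (*-identityˡ _) ⟩
    ⟦ ι R (q zero) ⟧ (λ u → G (u ++ []))            ≈⟨ ⟦⟧-cong (ι R (q zero)) (λ u → reflexive (≡.cong G (List.++-identityʳ u))) ⟩
    ⟦ ι R (q zero) ⟧ G                              ∎)

  γ-identityʳ : ∀ {n} (p : NMI R n) → _≈N_ R (γ R {m = λ _ → 1} p (λ _ → unit R)) p
  γ-identityʳ p = ⟦⟧⇒≈N (γ R {m = λ _ → 1} p (λ _ → unit R)) p (λ G → begin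
    ⟦ ι R (γ R p (λ _ → unit R)) ⟧ G
      ≈⟨ ⟦ιγ⟧ p (λ _ → unit R) G ⟩
    ⟦ p ⟧ (λ x → evalComp (lookup x) (derivs (λ _ → unit R)) G)
      ≈⟨ ⟦⟧-cong p (λ x → ⟦⟧ⁿ-point _ (λ j → lookup x j ∷ []) (λ j → ⟦D^unit⟧ (lookup x j)) _) ⟩
    ⟦ p ⟧ (λ x → G (concatWords (tabulate (λ j → lookup x j ∷ []))))
      ≈⟨ ⟦⟧-cong p (λ x → reflexive (≡.cong G (concat-singletons x))) ⟩
    ⟦ p ⟧ (G ∘ toList)
      ≡⟨ ≡.sym (⟦ι⟧ p G) ⟩
    ⟦ ι R p ⟧ G ∎)
    where
    ⟦D^unit⟧ : ∀ i G′ → ⟦ ι R (D^ R i (unit R)) ⟧ G′ ≈ G′ (i ∷ [])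
    ⟦D^unit⟧ i G′ rewrite D^-unit i = trans (+-identityʳ _) (*-identityˡ _)
    concat-singletons : ∀ {n} (x : Vec ℕ n) → concatWords (tabulate (λ j → lookup x j ∷ [])) ≡ toList x
    concat-singletons []      = ≡.refl
    concat-singletons (a ∷ x) = ≡.cong (a ∷_) (concat-singletons x)

  D^-cong : ∀ {n} i (q q′ : NMI R n) → _≈N_ R q q′ → _≈N_ R (D^ R i q) (D^ R i q′)
  D^-cong i q q′ q≈q′ = ⟦⟧⇒≈N (D^ R i q) (D^ R i q′) (λ G →
    trans (⟦ιD^⟧ i q G) (trans (≈P⇒⟦⟧ (ι R q) (ι R q′) q≈q′ _) (sym (⟦ιD^⟧ i q′ G))))

  γ-cong : ∀ {n} {m : Fin n → ℕ} (p p′ : NMI R n) (q q′ : (j : Fin n) → NMI R (m j)) →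
            _≈N_ R p p′ → (∀ j → _≈N_ R (q j) (q′ j)) → _≈N_ R (γ R p q) (γ R p′ q′)
  γ-cong p p′ q q′ p≈p′ q≈q′ = ⟦⟧⇒≈N (γ R p q) (γ R p′ q′) (λ G → begin
    ⟦ ι R (γ R p q) ⟧ G                                ≈⟨ ⟦ιγ⟧ p q G ⟩
    ⟦ p ⟧ (λ x → evalComp (lookup x) (derivs q) G)     ≈⟨ ≈N⇒⟦⟧ p p′ p≈p′ _ ⟩
    ⟦ p′ ⟧ (λ x → evalComp (lookup x) (derivs q) G)    ≈⟨ ⟦⟧-cong p′ (λ x → ⟦⟧ⁿ-pointwise _ _ (λ j → derivs-cong j (lookup x j)) _) ⟩
    ⟦ p′ ⟧ (λ x → evalComp (lookup x) (derivs q′) G)   ≈⟨ sym (⟦ιγ⟧ p′ q′ G) ⟩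
    ⟦ ι R (γ R p′ q′) ⟧ G                              ∎)
    where
    derivs-cong : ∀ j i → ∀ G → ⟦ derivs q j i ⟧ G ≈ ⟦ derivs q′ j i ⟧ G
    derivs-cong j i = ≈P⇒⟦⟧ (derivs q j i) (derivs q′ j i) (D^-cong i (q j) (q′ j) (q≈q′ j))

  -- Associativity: D is a derivation, so it commutes with composition

  ∂-++ : ∀ G (u v : Word R) → ∂ G (u ++ v) ≈ ∂ (λ u′ → G (u′ ++ v)) u + ∂ (λ v′ → G (u ++ v′)) v
  ∂-++ G []      v = sym (+-identityˡ _)
  ∂-++ G (i ∷ u) v = begin
    G (suc i ∷ u ++ v) + ∑ (map (i ∷_) (Dwordˡ (u ++ v))) G
      ≡⟨ ≡.cong (G (suc i ∷ u ++ v) +_) (∑-map (i ∷_) (Dwordˡ (u ++ v)) G) ⟩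
    G (suc i ∷ u ++ v) + ∂ (λ w → G (i ∷ w)) (u ++ v)
      ≈⟨ +-congˡ (∂-++ (λ w → G (i ∷ w)) u v) ⟩
    G (suc i ∷ u ++ v) + (∂ (λ u′ → G (i ∷ u′ ++ v)) u + ∂ (λ v′ → G (i ∷ u ++ v′)) v)
      ≈⟨ sym (+-assoc _ _ _) ⟩
    (G (suc i ∷ u ++ v) + ∂ (λ u′ → G (i ∷ u′ ++ v)) u) + ∂ (λ v′ → G (i ∷ u ++ v′)) v
      ≡⟨ ≡.cong (λ z → (G (suc i ∷ u ++ v) + z) + ∂ (λ v′ → G (i ∷ u ++ v′)) v) (≡.sym (∑-map (i ∷_) (Dwordˡ u) (λ u′ → G (u′ ++ v)))) ⟩
    ∂ (λ u′ → G (u′ ++ v)) (i ∷ u) + ∂ (λ v′ → G ((i ∷ u) ++ v′)) v ∎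

  ∂-evalComp : ∀ {n} (E : Fin n → ℕ → Poly R) → (∀ k i G → ⟦ E k (suc i) ⟧ G ≈ ⟦ E k i ⟧ (∂ G)) →
               ∀ (w : Word R) → length w ≡ n → ∀ G → evalComp (letter w) E (∂ G) ≈ ∂ (λ w′ → evalComp (letter w′) E G) w
  ∂-evalComp {zero}  E E-suc []      _   G = refl
  ∂-evalComp {suc n} E E-suc (i ∷ w) len G = begin
    ⟦ E zero i ⟧ (λ u → ⟦ rest ⟧ⁿ (λ vs → ∂ G (u ++ concatWords vs)))
      ≈⟨ ⟦⟧-cong (E zero i) (λ u → trans (⟦⟧ⁿ-cong rest (λ vs → ∂-++ G u (concatWords vs))) (⟦⟧ⁿ-+ rest _ _)) ⟩
    ⟦ E zero i ⟧ (λ u → ⟦ rest ⟧ⁿ (λ vs → ∂ (λ u′ → G (u′ ++ concatWords vs)) u) + ⟦ rest ⟧ⁿ (λ vs → ∂ (λ v′ → G (u ++ v′)) (concatWords vs)))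
      ≈⟨ ⟦⟧-+ (E zero i) _ _ ⟩
    ⟦ E zero i ⟧ (λ u → ⟦ rest ⟧ⁿ (λ vs → ∂ (λ u′ → G (u′ ++ concatWords vs)) u)) + ⟦ E zero i ⟧ (λ u → evalComp (letter w) (E ∘ suc) (∂ (λ v′ → G (u ++ v′))))
      ≈⟨ +-cong first-letter other-letters ⟩
    evalComp (letter (suc i ∷ w)) E G + ∑ (Dwordˡ w) (λ w′ → evalComp (letter (i ∷ w′)) E G)
      ≡⟨ ≡.cong (evalComp (letter (suc i ∷ w)) E G +_) (≡.sym (∑-map (i ∷_) (Dwordˡ w) (λ w′ → evalComp (letter w′) E G))) ⟩
    ∂ (λ w′ → evalComp (letter w′) E G) (i ∷ w) ∎
    where
    rest = λ k → E (suc k) (letter w k)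
    first-letter = begin
      ⟦ E zero i ⟧ (λ u → ⟦ rest ⟧ⁿ (λ vs → ∂ (λ u′ → G (u′ ++ concatWords vs)) u)) ≈⟨ ⟦⟧-cong (E zero i) (λ u → ⟦⟧ⁿ-∑ rest (Dwordˡ u) _) ⟩
      ⟦ E zero i ⟧ (∂ (λ u′ → ⟦ rest ⟧ⁿ (λ vs → G (u′ ++ concatWords vs))))          ≈⟨ sym (E-suc zero i _) ⟩
      evalComp (letter (suc i ∷ w)) E G                                              ∎
    other-letters = begin
      ⟦ E zero i ⟧ (λ u → evalComp (letter w) (E ∘ suc) (∂ (λ v′ → G (u ++ v′))))
        ≈⟨ ⟦⟧-cong (E zero i) (λ u → ∂-evalComp (E ∘ suc) (E-suc ∘ suc) w (ℕ.suc-injective len) (λ v′ → G (u ++ v′))) ⟩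
      ⟦ E zero i ⟧ (λ u → ∑ (Dwordˡ w) (λ w′ → evalComp (letter w′) (E ∘ suc) (λ v′ → G (u ++ v′))))
        ≈⟨ ⟦⟧-∑ (E zero i) (Dwordˡ w) _ ⟩
      ∑ (Dwordˡ w) (λ w′ → evalComp (letter (i ∷ w′)) E G) ∎

  ι-length : ∀ {n} (p : NMI R n) → All (λ t → length (proj₂ t) ≡ n) (ι R p)
  ι-length []      = []
  ι-length (t ∷ p) = Vec.length-toList (proj₂ t) ∷ ι-length p

  ⟦ιγ⟧ˡ : ∀ {n} {l : Fin n → ℕ} (q : NMI R n) (r : (k : Fin n) → NMI R (l k)) G →
          ⟦ ι R (γ R q r) ⟧ G ≈ ⟦ ι R q ⟧ (λ w → evalComp (letter w) (derivs r) G)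
  ⟦ιγ⟧ˡ q r G = begin
    ⟦ ι R (γ R q r) ⟧ G                                          ≈⟨ ⟦ιγ⟧ q r G ⟩
    ⟦ q ⟧ (λ x → evalComp (lookup x) (derivs r) G)               ≈⟨ ⟦⟧-cong q (λ x → ⟦⟧ⁿ-≡ _ _ (λ k → ≡.cong (derivs r k) (≡.sym (toList-! x k))) _) ⟩
    ⟦ q ⟧ (λ x → evalComp (letter (toList x)) (derivs r) G)      ≡⟨ ≡.sym (⟦ι⟧ q _) ⟩
    ⟦ ι R q ⟧ (λ w → evalComp (letter w) (derivs r) G)           ∎

  ⟦ιD^γ⟧ : ∀ {n} {l : Fin n → ℕ} (q : NMI R n) (r : (k : Fin n) → NMI R (l k)) i G →
           ⟦ ι R (D^ R i (γ R q r)) ⟧ G ≈ ⟦ ι R (D^ R i q) ⟧ (λ w → evalComp (letter w) (derivs r) G)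
  ⟦ιD^γ⟧ q r zero    G = ⟦ιγ⟧ˡ q r G
  ⟦ιD^γ⟧ q r (suc i) G = begin
    ⟦ ι R (D R (D^ R i (γ R q r))) ⟧ G                                ≈⟨ ⟦ιD^⟧ 1 (D^ R i (γ R q r)) G ⟩
    ⟦ ι R (D^ R i (γ R q r)) ⟧ (∂ G)                                  ≈⟨ ⟦ιD^γ⟧ q r i (∂ G) ⟩
    ⟦ ι R (D^ R i q) ⟧ (λ w → evalComp (letter w) (derivs r) (∂ G))   ≈⟨ ⟦⟧-congᴬ (ι R (D^ R i q)) (ι-length (D^ R i q)) (λ w len → ∂-evalComp (derivs r) derivs-suc w len G) ⟩
    ⟦ ι R (D^ R i q) ⟧ (∂ (λ w → evalComp (letter w) (derivs r) G))   ≈⟨ sym (⟦ιD^⟧ 1 (D^ R i q) _) ⟩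
    ⟦ ι R (D R (D^ R i q)) ⟧ (λ w → evalComp (letter w) (derivs r) G) ∎
    where
    derivs-suc : ∀ k j G → ⟦ derivs r k (suc j) ⟧ G ≈ ⟦ derivs r k j ⟧ (∂ G)
    derivs-suc k j G = trans (⟦ιD^⟧ (suc j) (r k) G) (sym (⟦ιD^⟧ j (r k) (∂ G)))

  -- The product (u_1 ∘ E_1) ⋯ (u_n ∘ E_n) paired with F
  evalBlocks : ∀ {n} {m : Fin n → ℕ} → ((j : Fin n) → Fin (m j) → ℕ → Poly R) → Vec (Word R) n → (Word R → Carrier) → Carrier
  evalBlocks E []       F = F []
  evalBlocks E (u ∷ us) F = evalComp (letter u) (E zero) (λ v → evalBlocks (E ∘ suc) us (λ v′ → F (v ++ v′)))

  evalComp-concat : ∀ {n} {m : Fin n → ℕ} (E : (j : Fin n) → Fin (m j) → ℕ → Poly R) (us : Vec (Word R) n) →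
                    (∀ j → length (lookup us j) ≡ m j) → ∀ F →
                    evalComp (letter (concatWords us)) (uncurry E ∘ unflatten m) F ≈ evalBlocks E us F
  evalComp-concat {zero}      E []       len F = refl
  evalComp-concat {suc n} {m} E (u ∷ us) len F = begin
    ⟦ X ⟧ⁿ (F ∘ concatWords)
      ≈⟨ ⟦⟧ⁿ-++ (m zero) X _ ⟩
    ⟦ (λ i → X (i ↑ˡ b)) ⟧ⁿ (λ vs₀ → ⟦ (λ i → X (m zero ↑ʳ i)) ⟧ⁿ (λ vs → F (concatWords (vs₀ Vec.++ vs))))
      ≈⟨ ⟦⟧ⁿ-cong (λ i → X (i ↑ˡ b)) (λ vs₀ → trans (⟦⟧ⁿ-cong (λ i → X (m zero ↑ʳ i)) (λ vs → reflexive (≡.cong F (concatWords-++ vs₀ vs))))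
                                                    (trans (⟦⟧ⁿ-≡ _ _ later-blocks _) (evalComp-concat (E ∘ suc) us (len ∘ suc) (λ v′ → F (concatWords vs₀ ++ v′))))) ⟩
    ⟦ (λ i → X (i ↑ˡ b)) ⟧ⁿ (λ vs₀ → evalBlocks (E ∘ suc) us (λ v′ → F (concatWords vs₀ ++ v′)))
      ≈⟨ ⟦⟧ⁿ-≡ _ _ first-block _ ⟩
    evalBlocks E (u ∷ us) F ∎
    where
    b = sumF (m ∘ suc)
    X = λ i → uncurry E (unflatten m i) (letter (u ++ concatWords us) i)
    first-block : ∀ i → X (i ↑ˡ b) ≡ E zero i (letter u i)
    first-block i = ≡.cong₂ (uncurry E) (unflatten-↑ˡ m i) (letter-++-↑ˡ u (concatWords us) b (len zero) i)
    later-blocks : ∀ i → X (m zero ↑ʳ i) ≡ uncurry (E ∘ suc) (unflatten (m ∘ suc) i) (letter (concatWords us) i)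
    later-blocks i = ≡.cong₂ (uncurry E) (unflatten-↑ʳ m i) (letter-++-↑ʳ u (concatWords us) (len zero) i)

  ⟦⟧ⁿ-evalBlocks : ∀ {n} {m : Fin n → ℕ} (E : (j : Fin n) → Fin (m j) → ℕ → Poly R) (L L′ : Fin n → Poly R) →
                   (∀ j G → ⟦ L′ j ⟧ G ≈ ⟦ L j ⟧ (λ w → evalComp (letter w) (E j) G)) →
                   ∀ F → ⟦ L′ ⟧ⁿ (F ∘ concatWords) ≈ ⟦ L ⟧ⁿ (λ us → evalBlocks E us F)
  ⟦⟧ⁿ-evalBlocks {zero}  E L L′ eq F = refl
  ⟦⟧ⁿ-evalBlocks {suc n} E L L′ eq F = begin
    ⟦ L′ zero ⟧ (λ u → ⟦ L′ ∘ suc ⟧ⁿ (λ vs → F (u ++ concatWords vs)))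
      ≈⟨ ⟦⟧-cong (L′ zero) (λ u → ⟦⟧ⁿ-evalBlocks (E ∘ suc) (L ∘ suc) (L′ ∘ suc) (eq ∘ suc) (λ v → F (u ++ v))) ⟩
    ⟦ L′ zero ⟧ (λ u → ⟦ L ∘ suc ⟧ⁿ (λ us → evalBlocks (E ∘ suc) us (λ v′ → F (u ++ v′))))
      ≈⟨ eq zero _ ⟩
    ⟦ L zero ⟧ (λ w → evalComp (letter w) (E zero) (λ v → ⟦ L ∘ suc ⟧ⁿ (λ us → evalBlocks (E ∘ suc) us (λ v′ → F (v ++ v′)))))
      ≈⟨ ⟦⟧-cong (L zero) (λ w → ⟦⟧ⁿ-comm (λ k → E zero k (letter w k)) (L ∘ suc) _) ⟩
    ⟦ L ⟧ⁿ (λ us → evalBlocks E us F) ∎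

  γ-assoc : ∀ {n} {m : Fin n → ℕ} {l : (j : Fin n) → Fin (m j) → ℕ}
            (p : NMI R n) (q : (j : Fin n) → NMI R (m j)) (r : (j : Fin n) (k : Fin (m j)) → NMI R (l j k)) →
            _≈N_ R (γ R {m = uncurry l ∘ unflatten m} (γ R p q) (uncurry r ∘ unflatten m))
                   (γ R {m = λ j → sumF (l j)} p (λ j → γ R (q j) (r j)))
  γ-assoc {n} {m} {l} p q r = ⟦⟧⇒≈N LHS RHS (λ F → begin
    ⟦ ι R LHS ⟧ F
      ≈⟨ ⟦ιγ⟧ˡ (γ R p q) (uncurry r ∘ unflatten m) F ⟩
    ⟦ ι R (γ R p q) ⟧ (λ w → evalComp (letter w) (uncurry E ∘ unflatten m) F)
      ≈⟨ ⟦ιγ⟧ p q _ ⟩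
    ⟦ p ⟧ (λ x → ⟦ Q x ⟧ⁿ (λ us → evalComp (letter (concatWords us)) (uncurry E ∘ unflatten m) F))
      ≈⟨ ⟦⟧-cong p (λ x → ⟦⟧ⁿ-congᴬ (Q x) (λ j w → length w ≡ m j) (λ j → ι-length (D^ R (lookup x j) (q j))) (λ us len → evalComp-concat E us len F)) ⟩
    ⟦ p ⟧ (λ x → ⟦ Q x ⟧ⁿ (λ us → evalBlocks E us F))
      ≈⟨ ⟦⟧-cong p (λ x → sym (⟦⟧ⁿ-evalBlocks E (Q x) _ (λ j G → ⟦ιD^γ⟧ (q j) (r j) (lookup x j) G) F)) ⟩
    ⟦ p ⟧ (λ x → evalComp (lookup x) (derivs (λ j → γ R (q j) (r j))) F)
      ≈⟨ sym (⟦ιγ⟧ p _ F) ⟩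
    ⟦ ι R RHS ⟧ F ∎)
    where
    LHS = γ R {m = uncurry l ∘ unflatten m} (γ R p q) (uncurry r ∘ unflatten m)
    RHS = γ R {m = λ j → sumF (l j)} p (λ j → γ R (q j) (r j))
    E = λ j → derivs (r j)
    Q = λ (x : Vec ℕ n) j → derivs q j (lookup x j)

  toList-blockPerm : ∀ {n} (σ : Permutation′ n) (m : Fin n → ℕ) (us : Vec (Word R) n) → (∀ j → length (lookup us j) ≡ m j) →
                     toList (tabulate (lookup (toVec {sumF m} (concatWords us)) ∘ blockPerm R σ m)) ≡ concatWords (permute σ us)
  toList-blockPerm σ m us len =
    ≡.trans (≡.cong toList (Vec.tabulate-cong (λ i → Vec.lookup∘tabulate (letter (concatWords us)) (blockPerm R σ m i))))
      (toList-tabulate-unflatten (m ∘ (σ ⟨$⟩ʳ_)) (permute σ us) len∘σ _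
        (λ k r → ≡.trans (letter-flatten m us len (σ ⟨$⟩ʳ k) r) (≡.cong (λ u → letter u r) (≡.sym (Vec.lookup∘tabulate _ k)))))
    where
    len∘σ : ∀ k → length (lookup (permute σ us) k) ≡ m (σ ⟨$⟩ʳ k)
    len∘σ k = ≡.trans (≡.cong length (Vec.lookup∘tabulate (lookup us ∘ (σ ⟨$⟩ʳ_)) k)) (len (σ ⟨$⟩ʳ k))

  toList-blockSum : ∀ {n} (m : Fin n → ℕ) (τ : (j : Fin n) → Permutation′ (m j)) (us : Vec (Word R) n) → (∀ j → length (lookup us j) ≡ m j) →
                    toList (tabulate (lookup (toVec {sumF m} (concatWords us)) ∘ blockSum R m τ)) ≡ concatWords (tabulate (λ j → permuteWord (τ j)) ⊛ us)
  toList-blockSum m τ us len =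
    ≡.trans (≡.cong toList (Vec.tabulate-cong (λ i → Vec.lookup∘tabulate (letter (concatWords us)) (blockSum R m τ i))))
      (toList-tabulate-unflatten m τus len-τus _
        (λ j r → ≡.trans (letter-flatten m us len j (τ j ⟨$⟩ʳ r)) (≡.sym (letter-τus j r))))
    where
    τus = tabulate (λ j → permuteWord (τ j)) ⊛ us
    lookup-τus : ∀ j → lookup τus j ≡ permuteWord (τ j) (lookup us j)
    lookup-τus j = ≡.trans (Vec.lookup-⊛ j (tabulate (λ j → permuteWord (τ j))) us)
                           (≡.cong (λ f → f (lookup us j)) (Vec.lookup∘tabulate (λ j → permuteWord (τ j)) j))
    len-τus : ∀ j → length (lookup τus j) ≡ m j
    len-τus j = ≡.trans (≡.cong length (lookup-τus j)) (Vec.length-toList (tabulate (λ r → letter (lookup us j) (τ j ⟨$⟩ʳ r))))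
    letter-τus : ∀ j r → letter (lookup τus j) r ≡ letter (lookup us j) (τ j ⟨$⟩ʳ r)
    letter-τus j r = ≡.trans (≡.cong (λ u → letter u r) (lookup-τus j))
                       (≡.trans (toList-! (tabulate (λ r → letter (lookup us j) (τ j ⟨$⟩ʳ r))) r) (Vec.lookup∘tabulate (λ r → letter (lookup us j) (τ j ⟨$⟩ʳ r)) r))

  module ∑ᶠ = MonoidSum +-commutativeMonoid

  ∑-Dword : ∀ {n} (x : Vec ℕ n) (H : Vec ℕ n → Carrier) → ∑ (Dword R x) H ≈ ∑ᶠ.sum (H ∘ bump x)
  ∑-Dword []      H = refl
  ∑-Dword (i ∷ x) H = trans (reflexive (≡.cong (H (suc i ∷ x) +_) (∑-map (i ∷_) (Dword R x) H))) (+-congˡ (∑-Dword x (H ∘ (i ∷_))))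

  ∂ᵛ-permute : ∀ {n} (τ : Permutation′ n) (H : Vec ℕ n → Carrier) y → ∂ᵛ H (permute τ y) ≈ ∂ᵛ (H ∘ permute τ) y
  ∂ᵛ-permute τ H y = begin
    ∂ᵛ H (permute τ y)                                 ≈⟨ ∑-Dword (permute τ y) H ⟩
    ∑ᶠ.sum (λ k → H (bump (permute τ y) k))            ≈⟨ ∑ᶠ.∑-permute (λ k → H (bump (permute τ y) k)) (Perm.flip τ) ⟩
    ∑ᶠ.sum (λ k → H (bump (permute τ y) (τ ⟨$⟩ˡ k)))   ≡⟨ ∑ᶠ.sum-cong-≗ (λ k → ≡.cong H (≡.sym (permute-bump τ y k))) ⟩
    ∑ᶠ.sum (λ k → H (permute τ (bump y k)))            ≈⟨ sym (∑-Dword y _) ⟩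
    ∂ᵛ (H ∘ permute τ) y                               ∎

  ∂ᵛ^-permute : ∀ {n} (τ : Permutation′ n) i (H : Vec ℕ n → Carrier) x → ∂ᵛ^ i H (permute τ x) ≈ ∂ᵛ^ i (H ∘ permute τ) x
  ∂ᵛ^-permute τ zero    H x = refl
  ∂ᵛ^-permute τ (suc i) H x = trans (∂ᵛ^-permute τ i (∂ᵛ H) x) (∂ᵛ^-cong i (∂ᵛ-permute τ H) x)

  ⟦ιD^-^⟧ : ∀ {k} (τ : Permutation′ k) (q : NMI R k) i G →
           ⟦ ι R (D^ R i (_^_ R q τ)) ⟧ G ≈ ⟦ ι R (D^ R i q) ⟧ (G ∘ permuteWord τ)
  ⟦ιD^-^⟧ τ q i G = begin
    ⟦ ι R (D^ R i (_^_ R q τ)) ⟧ G                  ≈⟨ ⟦ιD^⟧ i (_^_ R q τ) G ⟩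
    ⟦ ι R (_^_ R q τ) ⟧ (∂^ i G)                    ≡⟨ ⟦ιact⟧ _ q _ ⟩
    ⟦ q ⟧ (∂^ i G ∘ toList ∘ permute τ)             ≈⟨ ⟦⟧-cong q (λ x → sym (∂ᵛ^-toList i G (permute τ x))) ⟩
    ⟦ q ⟧ (∂ᵛ^ i (G ∘ toList) ∘ permute τ)          ≈⟨ ⟦⟧-cong q (∂ᵛ^-permute τ i _) ⟩
    ⟦ q ⟧ (∂ᵛ^ i (G ∘ toList ∘ permute τ))          ≈⟨ ⟦⟧-cong q (∂ᵛ^-cong i (λ y → reflexive (≡.cong G (toList-permute y)))) ⟩
    ⟦ q ⟧ (∂ᵛ^ i (G ∘ permuteWord τ ∘ toList))      ≈⟨ sym (⟦D^⟧ i q _) ⟩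
    ⟦ D^ R i q ⟧ (G ∘ permuteWord τ ∘ toList)       ≡⟨ ≡.sym (⟦ι⟧ (D^ R i q) _) ⟩
    ⟦ ι R (D^ R i q) ⟧ (G ∘ permuteWord τ)          ∎
    where
    toList-permute : ∀ y → toList (permute τ y) ≡ permuteWord τ (toList y)
    toList-permute y = ≡.cong toList (Vec.tabulate-cong (λ r → ≡.sym (toList-! y (τ ⟨$⟩ʳ r))))

  γ-equivariant-σ : ∀ {n} {m : Fin n → ℕ} (p : NMI R n) (q : (j : Fin n) → NMI R (m j)) (σ : Permutation′ n) →
                    _≈N_ R (γ R {m = m ∘ (σ ⟨$⟩ʳ_)} (_^_ R p σ) (q ∘ (σ ⟨$⟩ʳ_))) (act R (blockPerm R σ m) (γ R p q))
  γ-equivariant-σ {n} {m} p q σ = ⟦⟧⇒≈N LHS RHS (λ F → begin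
    ⟦ ι R LHS ⟧ F
      ≈⟨ ⟦ιγ⟧ (_^_ R p σ) _ F ⟩
    ⟦ _^_ R p σ ⟧ (λ x → evalComp (lookup x) (derivs (q ∘ (σ ⟨$⟩ʳ_))) F)
      ≡⟨ ⟦⟧-map (permute σ) p _ ⟩
    ⟦ p ⟧ (λ x → evalComp (lookup (permute σ x)) (derivs (q ∘ (σ ⟨$⟩ʳ_))) F)
      ≈⟨ ⟦⟧-cong p (λ x → ⟦⟧ⁿ-≡ _ (Q x ∘ (σ ⟨$⟩ʳ_)) (λ k → ≡.cong (derivs q (σ ⟨$⟩ʳ k)) (Vec.lookup∘tabulate _ k)) _) ⟩
    ⟦ p ⟧ (λ x → ⟦ Q x ∘ (σ ⟨$⟩ʳ_) ⟧ⁿ (F ∘ concatWords))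
      ≈⟨ ⟦⟧-cong p (λ x → ⟦⟧ⁿ-permute (Q x) σ _) ⟩
    ⟦ p ⟧ (λ x → ⟦ Q x ⟧ⁿ (F ∘ concatWords ∘ permute σ))
      ≈⟨ ⟦⟧-cong p (λ x → ⟦⟧ⁿ-congᴬ (Q x) (λ j w → length w ≡ m j) (λ j → ι-length (D^ R (lookup x j) (q j)))
                                   (λ us len → reflexive (≡.cong F (≡.sym (toList-blockPerm σ m us len))))) ⟩
    ⟦ p ⟧ (λ x → evalComp (lookup x) (derivs q) (reindexed F ∘ toVec))
      ≈⟨ sym (⟦ιγ⟧ p q _) ⟩
    ⟦ ι R (γ R p q) ⟧ (reindexed F ∘ toVec)
      ≈⟨ sym (⟦⟧-toVec (γ R p q) (reindexed F)) ⟩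
    ⟦ γ R p q ⟧ (reindexed F)
      ≡⟨ ≡.sym (⟦ιact⟧ (blockPerm R σ m) (γ R p q) F) ⟩
    ⟦ ι R RHS ⟧ F ∎)
    where
    LHS = γ R {m = m ∘ (σ ⟨$⟩ʳ_)} (_^_ R p σ) (q ∘ (σ ⟨$⟩ʳ_))
    RHS = act R (blockPerm R σ m) (γ R p q)
    Q = λ (x : Vec ℕ n) j → derivs q j (lookup x j)
    reindexed = λ (F : Word R → Carrier) (y : Vec ℕ (sumF m)) → F (toList (tabulate (lookup y ∘ blockPerm R σ m)))

  γ-equivariant-τ : ∀ {n} {m : Fin n → ℕ} (p : NMI R n) (q : (j : Fin n) → NMI R (m j)) (τ : (j : Fin n) → Permutation′ (m j)) →
                    _≈N_ R (γ R p (λ j → _^_ R (q j) (τ j))) (act R (blockSum R m τ) (γ R p q))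
  γ-equivariant-τ {n} {m} p q τ = ⟦⟧⇒≈N LHS RHS (λ F → begin
    ⟦ ι R LHS ⟧ F
      ≈⟨ ⟦ιγ⟧ p _ F ⟩
    ⟦ p ⟧ (λ x → evalComp (lookup x) (derivs (λ j → _^_ R (q j) (τ j))) F)
      ≈⟨ ⟦⟧-cong p (λ x → ⟦⟧ⁿ-map _ (Q x) (λ j → permuteWord (τ j)) (λ j G → ⟦ιD^-^⟧ (τ j) (q j) (lookup x j) G) _) ⟩
    ⟦ p ⟧ (λ x → ⟦ Q x ⟧ⁿ (λ us → F (concatWords (tabulate (λ j → permuteWord (τ j)) ⊛ us))))
      ≈⟨ ⟦⟧-cong p (λ x → ⟦⟧ⁿ-congᴬ (Q x) (λ j w → length w ≡ m j) (λ j → ι-length (D^ R (lookup x j) (q j)))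
                                   (λ us len → reflexive (≡.cong F (≡.sym (toList-blockSum m τ us len))))) ⟩
    ⟦ p ⟧ (λ x → evalComp (lookup x) (derivs q) (reindexed F ∘ toVec))
      ≈⟨ sym (⟦ιγ⟧ p q _) ⟩
    ⟦ ι R (γ R p q) ⟧ (reindexed F ∘ toVec)
      ≈⟨ sym (⟦⟧-toVec (γ R p q) (reindexed F)) ⟩
    ⟦ γ R p q ⟧ (reindexed F)
      ≡⟨ ≡.sym (⟦ιact⟧ (blockSum R m τ) (γ R p q) F) ⟩
    ⟦ ι R RHS ⟧ F ∎)
    where
    LHS = γ R p (λ j → _^_ R (q j) (τ j))
    RHS = act R (blockSum R m τ) (γ R p q)
    Q = λ (x : Vec ℕ n) j → derivs q j (lookup x j)
    reindexed = λ (F : Word R → Carrier) (y : Vec ℕ (sumF m)) → F (toList (tabulate (lookup y ∘ blockSum R m τ)))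

proposition2p3 : ∀ {c ℓ} (K : CommutativeRing c ℓ) → IsFieldChar0 K → IsNMIOperad K
proposition2p3 K _ = record
  { γ-cong     = λ p p′ q q′ _ _ → γ-cong K p p′ q q′
  ; act-cong   = λ p p′ σ _ → ^-cong K p p′ σ
  ; act-id     = λ p _ → ^-idₚ K p
  ; act-comp   = λ p σ τ _ → ^-∘ₚ K p σ τ
  ; unit-left  = λ m q _ → γ-identityˡ K m q
  ; unit-right = λ p _ → γ-identityʳ K p
  ; assoc      = λ p q r _ _ _ → γ-assoc K p q r
  ; equiv-σ    = λ p q σ _ _ → γ-equivariant-σ K p q σ
  ; equiv-τ    = λ p q τ _ _ → γ-equivariant-τ K p q τ
  }
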